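{- Let $M=[1,1,0,2]$ and $I=[2,0,0,2]$. For all integers $a_0\ge1$, $b_0\ge0$, $n\ge0$ and $k$, $$\mathbb{P}\bigl[A(M,n,a_0,b_0)=a_0+k\bigr]=\sum_{i=0}^{n}\mathbb{P}\bigl[A(M,i,a_0,0)=a_0+k\bigr]\,\mathbb{P}\bigl[A(I,n,a_0,b_0)=a_0+2i\bigr].$$
   Context: Two-color Pólya urn: initially $a_0$ balls of color $A$ and $b_0$ of color $B$; in each step a ball is drawn uniformly at random and returned, and then for replacement matrix $[\alpha,\beta,\gamma,\delta]$: if it was of color $A$, $\alpha$ balls of color $A$ and $\beta$ of color $B$ are added; if of color $B$, $\gamma$ of color $A$ and $\delta$ of color $B$ are added. $A(M,n,a_0,b_0)$ is the number of balls of color $A$ after $n$ steps with replacement matrix $M$ and initial configuration $(a_0,b_0)$. -}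

module Defs where

open import Data.Nat using (ℕ; zero; suc; _+_)
open import Data.Integer using (ℤ; +_)
open import Data.Rational using (ℚ; 0ℚ; 1ℚ; _/_) renaming (_+_ to _+ℚ_; _*_ to _*ℚ_)
open import Relation.Binary.PropositionalEquality using (_≡_)
open import Relation.Nullary using (yes; no)
open import Data.Integer using (_≟_)

record Matrix : Set where
  constructor [_,_,_,_]
  field
    α β γ δ : ℕ

open Matrix public

-- probability a / t of drawing a given color (t = total number of balls);
-- an empty urn (t = 0) never occurs from the initial configurations we use
frac : ℕ → ℕ → ℚ
frac a zero    = 0ℚ
frac a (suc t) = (+ a) / suc t

ind : ℕ → ℤ → ℚ
ind a x with + a ≟ x
... | yes _ = 1ℚ
... | no  _ = 0ℚ

-- Prob M n a b x  =  P[ A(M, n, a, b) = x ]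
-- (urn started with a balls of colour A and b of colour B)
Prob : Matrix → ℕ → ℕ → ℕ → ℤ → ℚ
Prob M zero    a b x = ind a x
Prob M (suc n) a b x =
  (frac a (a + b) *ℚ Prob M n (a + α M) (b + β M) x)
  +ℚ (frac b (a + b) *ℚ Prob M n (a + γ M) (b + δ M) x)

Σ≤ : ℕ → (ℕ → ℚ) → ℚ
Σ≤ zero    f = f 0
Σ≤ (suc n) f = Σ≤ n f +ℚ f (suc n)

Mₘ : Matrix
Mₘ = [ 1 , 1 , 0 , 2 ]

Iₘ : Matrix
Iₘ = [ 2 , 0 , 0 , 2 ]

module Submission where

-- Split the colour-B balls of an M-urn into c "active" and b "passive" ones.
-- A draw of an active ball (colour A or active B) evolves the active part
-- (a, c) exactly like an M-urn started at (a, c) and adds 2 active balls;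
-- a draw of a passive ball only adds 2 passive balls.  Hence after n steps,
-- i of which drew an active ball, there are s + 2i active balls (s = a + c),
-- and the law of this count is that of the colour-A count of an I-urn
-- started at (s, b).  Conditioning on i gives (lemma `decomposition`)
--   P[A(M,n,a,c+b) = x] = Σ_{i≤n} P[A(M,i,a,c) = x] · P[A(I,n,s,b) = s+2i],
-- proved by induction on n: both sides satisfy the same first-step
-- recursion (`P-step`, `Mixture-step`); for the right-hand side this uses
-- that the I-urn count stays within [s, s + 2n] (`Prob-below`,
-- `Prob-above`).  The theorem is the
-- case c = 0.

open import Defs
open import Data.Nat using (ℕ; zero; suc; _+_; _*_; _≥_; _≤_; _<_; z≤n; z<s)
import Data.Nat.Properties as ℕP
open import Data.Nat.Tactic.RingSolver using (solve-∀)
open import Data.Integer as ℤ using (ℤ; +_)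
import Data.Integer.Properties as ℤP
open import Data.Rational using (ℚ; 0ℚ; 1ℚ; toℚᵘ)
  renaming (_+_ to _+ℚ_; _*_ to _*ℚ_)
open import Data.Rational.Properties
  using (toℚᵘ-injective; toℚᵘ-fromℚᵘ; toℚᵘ-homo-+; toℚᵘ-homo-*; 0/n≡0;
         *-zeroˡ; *-zeroʳ; *-identityʳ; +-identityˡ; +-identityʳ)
open import Data.Rational.Solver using (module +-*-Solver)
import Data.Rational.Unnormalised as ℚᵘ
import Data.Rational.Unnormalised.Properties as ℚᵘP
open import Relation.Binary.PropositionalEquality
open import Relation.Nullary using (yes; no)
open import Data.Empty using (⊥-elim)

open +-*-Solver using (solve; _:+_; _:*_; _:=_)

toℚᵘ-frac : ∀ a t → toℚᵘ (frac a (suc t)) ℚᵘ.≃ (+ a) ℚᵘ./ suc t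
toℚᵘ-frac a t = toℚᵘ-fromℚᵘ ((+ a) ℚᵘ./ suc t)

frac-zero : ∀ T → frac 0 T ≡ 0ℚ
frac-zero zero    = refl
frac-zero (suc t) = 0/n≡0 (suc t)

frac-+ : ∀ c b T → frac (c + b) T ≡ frac c T +ℚ frac b T
frac-+ c b zero    = refl
frac-+ c b (suc t) = toℚᵘ-injective (begin
  toℚᵘ (frac (c + b) T)                  ≈⟨ toℚᵘ-frac (c + b) t ⟩
  + (c + b) ℚᵘ./ T                       ≈⟨ ℚᵘP.*-cancelʳ-/ T ⟨
  (+ (c + b) ℤ.* + T) ℚᵘ./ (T * T)       ≡⟨ cong (λ z → z ℚᵘ./ (T * T)) numerator ⟩
  (+ c ℚᵘ./ T) ℚᵘ.+ (+ b ℚᵘ./ T)         ≈⟨ ℚᵘP.+-cong (toℚᵘ-frac c t) (toℚᵘ-frac b t) ⟨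
  toℚᵘ (frac c T) ℚᵘ.+ toℚᵘ (frac b T)   ≈⟨ toℚᵘ-homo-+ (frac c T) (frac b T) ⟨
  toℚᵘ (frac c T +ℚ frac b T)            ∎)
  where
  open ℚᵘP.≃-Reasoning
  T = suc t
  numerator : + (c + b) ℤ.* + T ≡ + c ℤ.* + T ℤ.+ + b ℤ.* + T
  numerator = trans (cong (ℤ._* + T) (ℤP.pos-+ c b)) (ℤP.*-distribʳ-+ (+ T) (+ c) (+ b))

frac-chain : ∀ {a s} T → a ≤ s → frac s T *ℚ frac a s ≡ frac a T
frac-chain {s = zero}  T z≤n = trans (*-zeroʳ (frac 0 T)) (sym (frac-zero T))
frac-chain {a} {suc m} zero _ = *-zeroˡ (frac a (suc m))
frac-chain {a} {suc m} (suc t) _ = toℚᵘ-injective (begin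
  toℚᵘ (frac S T *ℚ frac a S)           ≈⟨ toℚᵘ-homo-* (frac S T) (frac a S) ⟩
  toℚᵘ (frac S T) ℚᵘ.* toℚᵘ (frac a S)  ≈⟨ ℚᵘP.*-cong (toℚᵘ-frac S t) (toℚᵘ-frac a m) ⟩
  (+ S ℤ.* + a) ℚᵘ./ (T * S)            ≡⟨ ℚᵘP./-cong refl (ℕP.*-comm T S) ⟩
  (+ S ℤ.* + a) ℚᵘ./ (S * T)            ≈⟨ ℚᵘP.*-cancelˡ-/ S ⟩
  + a ℚᵘ./ T                            ≈⟨ toℚᵘ-frac a t ⟨
  toℚᵘ (frac a T)                       ∎)
  where
  open ℚᵘP.≃-Reasoning
  S = suc m
  T = suc t

Σ≤-cong : ∀ n {f g : ℕ → ℚ} → (∀ i → f i ≡ g i) → Σ≤ n f ≡ Σ≤ n g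
Σ≤-cong zero    f≡g = f≡g 0
Σ≤-cong (suc n) f≡g = cong₂ _+ℚ_ (Σ≤-cong n f≡g) (f≡g (suc n))

Σ≤-linear : ∀ n p q (f g : ℕ → ℚ) →
  Σ≤ n (λ i → p *ℚ f i +ℚ q *ℚ g i) ≡ p *ℚ Σ≤ n f +ℚ q *ℚ Σ≤ n g
Σ≤-linear zero    p q f g = refl
Σ≤-linear (suc n) p q f g =
  trans (cong (_+ℚ (p *ℚ f (suc n) +ℚ q *ℚ g (suc n))) (Σ≤-linear n p q f g))
        (regroup p q (Σ≤ n f) (Σ≤ n g) (f (suc n)) (g (suc n)))
  where
  regroup : ∀ p q F G x y →
    (p *ℚ F +ℚ q *ℚ G) +ℚ (p *ℚ x +ℚ q *ℚ y) ≡ p *ℚ (F +ℚ x) +ℚ q *ℚ (G +ℚ y)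
  regroup = solve 6 (λ p q F G x y →
    (p :* F :+ q :* G) :+ (p :* x :+ q :* y) := p :* (F :+ x) :+ q :* (G :+ y)) refl

Σ≤-dropFirst : ∀ n (f : ℕ → ℚ) → f 0 ≡ 0ℚ → Σ≤ (suc n) f ≡ Σ≤ n (λ j → f (suc j))
Σ≤-dropFirst zero    f f0≡0 = trans (cong (_+ℚ f 1) f0≡0) (+-identityˡ (f 1))
Σ≤-dropFirst (suc n) f f0≡0 = cong (_+ℚ f (suc (suc n))) (Σ≤-dropFirst n f f0≡0)

Σ≤-dropLast : ∀ n (f : ℕ → ℚ) → f (suc n) ≡ 0ℚ → Σ≤ (suc n) f ≡ Σ≤ n f
Σ≤-dropLast n f fn≡0 = trans (cong (Σ≤ n f +ℚ_) fn≡0) (+-identityʳ (Σ≤ n f))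

ind-self : ∀ m → ind m (+ m) ≡ 1ℚ
ind-self m with + m ℤ.≟ + m
... | yes _  = refl
... | no m≢m = ⊥-elim (m≢m refl)

ind-ne : ∀ {m y} → m ≢ y → ind m (+ y) ≡ 0ℚ
ind-ne {m} {y} m≢y with + m ℤ.≟ + y
... | yes m≡y = ⊥-elim (m≢y (ℤP.+-injective m≡y))
... | no _    = refl

both-zero : ∀ p q → p *ℚ 0ℚ +ℚ q *ℚ 0ℚ ≡ 0ℚ
both-zero p q = trans (cong₂ _+ℚ_ (*-zeroʳ p) (*-zeroʳ q)) (+-identityʳ 0ℚ)

-- The colour-A count never decreases.
Prob-below : ∀ M n a b y → y < a → Prob M n a b (+ y) ≡ 0ℚ
Prob-below M zero    a b y y<a = ind-ne (ℕP.>⇒≢ y<a)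
Prob-below M (suc n) a b y y<a =
  trans (cong₂ (λ u v → frac a (a + b) *ℚ u +ℚ frac b (a + b) *ℚ v)
               (Prob-below M n _ _ y (ℕP.m≤n⇒m≤n+o (α M) y<a))
               (Prob-below M n _ _ y (ℕP.m≤n⇒m≤n+o (γ M) y<a)))
        (both-zero (frac a (a + b)) (frac b (a + b)))

Prob-above : ∀ M d → α M ≤ d → γ M ≤ d →
  ∀ n a b y → a + d * n < y → Prob M n a b (+ y) ≡ 0ℚ
Prob-above M d α≤d γ≤d zero    a b y a<y =
  ind-ne (ℕP.<⇒≢ (ℕP.≤-<-trans (ℕP.m≤m+n a (d * 0)) a<y))
Prob-above M d α≤d γ≤d (suc n) a b y a<y =
  trans (cong₂ (λ u v → frac a (a + b) *ℚ u +ℚ frac b (a + b) *ℚ v)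
               (Prob-above M d α≤d γ≤d n _ _ y (grown α≤d))
               (Prob-above M d α≤d γ≤d n _ _ y (grown γ≤d)))
        (both-zero (frac a (a + b)) (frac b (a + b)))
  where
  bound′ : ∀ a d n → a + d + d * n ≡ a + d * suc n
  bound′ = solve-∀
  grown : ∀ {e} → e ≤ d → a + e + d * n < y
  grown e≤d = ℕP.≤-<-trans
    (ℕP.≤-trans (ℕP.+-monoˡ-≤ (d * n) (ℕP.+-monoʳ-≤ a e≤d)) (ℕP.≤-reflexive (bound′ a d n))) a<y

P : ℕ → ℕ → ℕ → ℤ → ℚ
P = Prob Mₘ

Q : ℕ → ℕ → ℕ → ℤ → ℚ
Q = Prob Iₘ

-- The right-hand side of the decomposition for an M-urn with a balls of
-- colour A, c active and b passive balls of colour B, s = a + c active in all.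
Mixture : (n a c b s : ℕ) → ℤ → ℚ
Mixture n a c b s x = Σ≤ n (λ i → P i a c x *ℚ Q n s b (+ (s + 2 * i)))

-- First-step analysis with three kinds of draws: an active ball (probability
-- (a+c)/T), which is of colour A or active B, or a passive ball (b/T);
-- u, v, w are the continuations after each of the three kinds.
firstStep : (a c b T : ℕ) → ℚ → ℚ → ℚ → ℚ
firstStep a c b T u v w =
  frac (a + c) T *ℚ (frac a (a + c) *ℚ u +ℚ frac c (a + c) *ℚ v) +ℚ frac b T *ℚ w

firstStep-cong : ∀ a c b T {u u′ v v′ w w′} → u ≡ u′ → v ≡ v′ → w ≡ w′ →
  firstStep a c b T u v w ≡ firstStep a c b T u′ v′ w′
firstStep-cong a c b T refl refl refl = refl

-- The M-urn itself satisfies the three-way first-step recursion: drawing a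
-- colour-B ball splits into drawing an active or a passive one.
P-step : ∀ n a c b x → P (suc n) a (c + b) x ≡
  firstStep a c b (a + (c + b)) (P n (a + 1) (c + 1 + b) x) (P n a (c + b + 2) x) (P n a (c + b + 2) x)
P-step n a c b x = begin
  frac a T *ℚ P n (a + 1) (c + b + 1) x +ℚ frac (c + b) T *ℚ P n (a + 0) (c + b + 2) x
    ≡⟨ cong₂ (λ y z → frac a T *ℚ P n (a + 1) y x +ℚ frac (c + b) T *ℚ P n z (c + b + 2) x)
             (swap c b) (ℕP.+-identityʳ a) ⟩
  frac a T *ℚ X +ℚ frac (c + b) T *ℚ Y
    ≡⟨ cong (λ z → frac a T *ℚ X +ℚ z *ℚ Y) (frac-+ c b T) ⟩
  frac a T *ℚ X +ℚ (frac c T +ℚ frac b T) *ℚ Y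
    ≡⟨ cong₂ (λ p q → p *ℚ X +ℚ (q +ℚ frac b T) *ℚ Y)
             (sym (frac-chain T (ℕP.m≤m+n a c))) (sym (frac-chain T (ℕP.m≤n+m c a))) ⟩
  (φ *ℚ frac a (a + c)) *ℚ X +ℚ (φ *ℚ frac c (a + c) +ℚ frac b T) *ℚ Y
    ≡⟨ regroup φ (frac a (a + c)) (frac c (a + c)) (frac b T) X Y ⟩
  firstStep a c b T X Y Y ∎
  where
  open ≡-Reasoning
  T = a + (c + b)
  φ = frac (a + c) T
  X = P n (a + 1) (c + 1 + b) x
  Y = P n a (c + b + 2) x
  swap : ∀ c b → c + b + 1 ≡ c + 1 + b
  swap = solve-∀
  regroup : ∀ φ α β ψ X Y →
    (φ *ℚ α) *ℚ X +ℚ (φ *ℚ β +ℚ ψ) *ℚ Y ≡ φ *ℚ (α *ℚ X +ℚ β *ℚ Y) +ℚ ψ *ℚ Y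
  regroup = solve 6 (λ φ α β ψ X Y →
    (φ :* α) :* X :+ (φ :* β :+ ψ) :* Y := φ :* (α :* X :+ β :* Y) :+ ψ :* Y) refl

Q-step : ∀ n s b T → s + b ≡ T → ∀ y →
  Q (suc n) s b y ≡ frac s T *ℚ Q n (s + 2) b y +ℚ frac b T *ℚ Q n s (b + 2) y
Q-step n s b _ refl y rewrite ℕP.+-identityʳ b | ℕP.+-identityʳ s = refl

-- Terms of the mixture where the first draw is active: the first term
-- vanishes (the I-urn count is at least s + 2), and the rest is the
-- first-step analysis of P (i+1) a c inside the sum.
Mixture-active : ∀ n a c b x →
  Σ≤ (suc n) (λ i → P i a c x *ℚ Q n (a + c + 2) b (+ (a + c + 2 * i)))
    ≡ frac a (a + c) *ℚ Mixture n (a + 1) (c + 1) b (a + c + 2) x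
      +ℚ frac c (a + c) *ℚ Mixture n a (c + 2) b (a + c + 2) x
Mixture-active n a c b x = begin
  Σ≤ (suc n) (λ i → P i a c x *ℚ g i)
    ≡⟨ Σ≤-dropFirst n (λ i → P i a c x *ℚ g i)
         (trans (cong (P 0 a c x *ℚ_) (Prob-below Iₘ n _ b _ below)) (*-zeroʳ (P 0 a c x))) ⟩
  Σ≤ n (λ j → P (suc j) a c x *ℚ g (suc j))
    ≡⟨ Σ≤-cong n (λ j → cong₂ (λ z w → (pA *ℚ u j +ℚ pC *ℚ P j z (c + 2) x) *ℚ Q n s₂ b (+ w))
                              (ℕP.+-identityʳ a) (shift j)) ⟩
  Σ≤ n (λ j → (pA *ℚ u j +ℚ pC *ℚ v j) *ℚ g′ j)
    ≡⟨ Σ≤-cong n (λ j → distrib pA (u j) pC (v j) (g′ j)) ⟩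
  Σ≤ n (λ j → pA *ℚ (u j *ℚ g′ j) +ℚ pC *ℚ (v j *ℚ g′ j))
    ≡⟨ Σ≤-linear n pA pC (λ j → u j *ℚ g′ j) (λ j → v j *ℚ g′ j) ⟩
  pA *ℚ Mixture n (a + 1) (c + 1) b s₂ x +ℚ pC *ℚ Mixture n a (c + 2) b s₂ x ∎
  where
  open ≡-Reasoning
  s₂ = a + c + 2
  pA = frac a (a + c)
  pC = frac c (a + c)
  g : ℕ → ℚ
  g i = Q n s₂ b (+ (a + c + 2 * i))
  g′ u v : ℕ → ℚ
  g′ j = Q n s₂ b (+ (s₂ + 2 * j))
  u j = P j (a + 1) (c + 1) x
  v j = P j a (c + 2) x
  below : a + c + 2 * 0 < s₂
  below = ℕP.+-monoʳ-< (a + c) z<s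
  shift′ : ∀ a c j → a + c + 2 * suc j ≡ a + c + 2 + 2 * j
  shift′ = solve-∀
  shift : ∀ j → a + c + 2 * suc j ≡ s₂ + 2 * j
  shift = shift′ a c
  distrib : ∀ α u β v g → (α *ℚ u +ℚ β *ℚ v) *ℚ g ≡ α *ℚ (u *ℚ g) +ℚ β *ℚ (v *ℚ g)
  distrib = solve 5 (λ α u β v g →
    (α :* u :+ β :* v) :* g := α :* (u :* g) :+ β :* (v :* g)) refl

-- Terms of the mixture where the first draw is passive: the last term
-- vanishes (the I-urn count is at most s + 2n).
Mixture-passive : ∀ n a c b x →
  Σ≤ (suc n) (λ i → P i a c x *ℚ Q n (a + c) (b + 2) (+ (a + c + 2 * i)))
    ≡ Mixture n a c (b + 2) (a + c) x
Mixture-passive n a c b x =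
  Σ≤-dropLast n _ (trans (cong (P (suc n) a c x *ℚ_)
                             (Prob-above Iₘ 2 ℕP.≤-refl z≤n n _ _ _ above))
                         (*-zeroʳ (P (suc n) a c x)))
  where
  above : a + c + 2 * n < a + c + 2 * suc n
  above = ℕP.+-monoʳ-< (a + c) (ℕP.*-monoʳ-< 2 (ℕP.n<1+n n))

Mixture-step : ∀ n a c b T → a + c + b ≡ T → ∀ x →
  Mixture (suc n) a c b (a + c) x ≡
  firstStep a c b T (Mixture n (a + 1) (c + 1) b (a + c + 2) x)
                    (Mixture n a (c + 2) b (a + c + 2) x)
                    (Mixture n a c (b + 2) (a + c) x)
Mixture-step n a c b T s+b≡T x = begin
  Σ≤ (suc n) (λ i → f i *ℚ Q (suc n) s b (+ (s + 2 * i)))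
    ≡⟨ Σ≤-cong (suc n) (λ i → trans (cong (f i *ℚ_) (Q-step n s b T s+b≡T _))
                                    (distrib (f i) φ (g i) ψ (h i))) ⟩
  Σ≤ (suc n) (λ i → φ *ℚ (f i *ℚ g i) +ℚ ψ *ℚ (f i *ℚ h i))
    ≡⟨ Σ≤-linear (suc n) φ ψ (λ i → f i *ℚ g i) (λ i → f i *ℚ h i) ⟩
  φ *ℚ Σ≤ (suc n) (λ i → f i *ℚ g i) +ℚ ψ *ℚ Σ≤ (suc n) (λ i → f i *ℚ h i)
    ≡⟨ cong₂ (λ y z → φ *ℚ y +ℚ ψ *ℚ z) (Mixture-active n a c b x) (Mixture-passive n a c b x) ⟩
  firstStep a c b T _ _ _ ∎
  where
  open ≡-Reasoning
  s = a + c
  φ = frac s T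
  ψ = frac b T
  f g h : ℕ → ℚ
  f i = P i a c x
  g i = Q n (s + 2) b (+ (s + 2 * i))
  h i = Q n s (b + 2) (+ (s + 2 * i))
  distrib : ∀ f φ g ψ h → f *ℚ (φ *ℚ g +ℚ ψ *ℚ h) ≡ φ *ℚ (f *ℚ g) +ℚ ψ *ℚ (f *ℚ h)
  distrib = solve 5 (λ f φ g ψ h →
    f :* (φ :* g :+ ψ :* h) := φ :* (f :* g) :+ ψ :* (f :* h)) refl

decomposition : ∀ n a c b s → a + c ≡ s → ∀ x → P n a (c + b) x ≡ Mixture n a c b s x
decomposition zero a c b _ refl x =
  sym (trans (cong (ind a x *ℚ_) (trans (cong (λ z → ind (a + c) (+ z)) (ℕP.+-identityʳ (a + c)))
                                        (ind-self (a + c))))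
             (*-identityʳ (ind a x)))
decomposition (suc n) a c b _ refl x = begin
  P (suc n) a (c + b) x
    ≡⟨ P-step n a c b x ⟩
  firstStep a c b T (P n (a + 1) (c + 1 + b) x) (P n a (c + b + 2) x) (P n a (c + b + 2) x)
    ≡⟨ firstStep-cong a c b T colourA activeB passiveB ⟩
  firstStep a c b T _ _ _
    ≡⟨ Mixture-step n a c b T (ℕP.+-assoc a c b) x ⟨
  Mixture (suc n) a c b (a + c) x ∎
  where
  open ≡-Reasoning
  T = a + (c + b)
  activeTotal : ∀ a c → a + 1 + (c + 1) ≡ a + c + 2
  activeTotal = solve-∀
  moveTwo : ∀ c b → c + b + 2 ≡ c + 2 + b
  moveTwo = solve-∀
  colourA : P n (a + 1) (c + 1 + b) x ≡ Mixture n (a + 1) (c + 1) b (a + c + 2) x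
  colourA = decomposition n (a + 1) (c + 1) b _ (activeTotal a c) x
  activeB : P n a (c + b + 2) x ≡ Mixture n a (c + 2) b (a + c + 2) x
  activeB = trans (cong (λ z → P n a z x) (moveTwo c b))
                  (decomposition n a (c + 2) b _ (sym (ℕP.+-assoc a c 2)) x)
  passiveB : P n a (c + b + 2) x ≡ Mixture n a c (b + 2) (a + c) x
  passiveB = trans (cong (λ z → P n a z x) (ℕP.+-assoc c b 2)) (decomposition n a c (b + 2) _ refl x)

lemma12 : (a₀ b₀ n : ℕ) (k : ℤ) → a₀ ≥ 1 →
    Prob Mₘ n a₀ b₀ ((+ a₀) ℤ.+ k)
    ≡ Σ≤ n (λ i → Prob Mₘ i a₀ 0 ((+ a₀) ℤ.+ k) *ℚ Prob Iₘ n a₀ b₀ (+ (a₀ + 2 * i)))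
lemma12 a₀ b₀ n k _ = decomposition n a₀ 0 b₀ a₀ (ℕP.+-identityʳ a₀) ((+ a₀) ℤ.+ k)
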